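{- Let $(C,\sqsubseteq)$ and $(A,\leq)$ be complete lattices. Let $E_C$ be a system of $m$ equations $x_i =_{\eta_i} f^C_i(x_1,\ldots,x_m)$ ($i=1,\ldots,m$) over $C$ and $E_A$ a system of $m$ equations $x_i =_{\eta_i} f^A_i(x_1,\ldots,x_m)$ over $A$ (with the same $\eta_i\in\{\mu,\nu\}$), where all $f^C_i\colon C^m\to C$ and $f^A_i\colon A^m\to A$ are monotone, and let $\vec{s}^C\in C^m$ and $\vec{s}^A\in A^m$ be their solutions. Let $\vec{\gamma}=(\gamma_1,\ldots,\gamma_m)$ be monotone functions $\gamma_i\colon A\to C$. If $$\vec{f}^C\circ \vec{\gamma}^\times \sqsubseteq \vec{\gamma}^\times\circ \vec{f}^A$$ (pointwise, as functions $A^m\to C^m$), and $\gamma_i$ is co-continuous and co-strict for each $i\in\{1,\ldots,m\}$ with $\eta_i=\nu$, then $\vec{s}^C\sqsubseteq \vec{\gamma}^\times(\vec{s}^A)$.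
   Context: Tuples $L^m$ of a complete lattice $L$ are ordered pointwise. A tuple $\vec{f}=(f_1,\ldots,f_m)$ of functions $f_i\colon L^m\to L$ is viewed as a function $L^m\to L^m$. For a tuple $\vec{\gamma}$ of functions $\gamma_i\colon A\to C$, the product function $\vec{\gamma}^\times\colon A^m\to C^m$ is $\vec{\gamma}^\times(a_1,\ldots,a_m)=(\gamma_1(a_1),\ldots,\gamma_m(a_m))$. A system of equations over a complete lattice $L$ is a list $x_i=_{\eta_i} f_i(x_1,\ldots,x_m)$, $i=1,\ldots,m$, with $f_i\colon L^m\to L$ monotone and $\eta_i\in\{\mu,\nu\}$. For such a system $E$, an index $i$ and $l\in L$, $E[x_i:=l]$ denotes the system of $m-1$ equations obtained by removing the $i$-th equation and replacing $x_i$ by $l$ in the remaining ones. The solution $\mathrm{sol}(E)\in L^m$ is defined inductively: the empty system has solution $()$, and $\mathrm{sol}(E)=(\mathrm{sol}(E[x_m:=s_m]),s_m)$ where $s_m=\eta_m(\lambda x.\, f_m(\mathrm{sol}(E[x_m:=x]),x))$, with $\mu g$/$\nu g$ the least/greatest fixpoint of a monotone $g$. A function is co-continuous if it preserves meets of non-empty downward directed sets (filtered sets), and co-strict if it preserves the top element. -}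

module Defs where

open import Level using (Level; Lift)
open import Data.Empty using (⊥)
open import Data.Nat using (ℕ)
import Data.Nat as N
open import Data.Fin using (Fin; zero; suc; inject₁; fromℕ)
open import Data.Product using (Σ; Σ-syntax; ∃; _×_)
open import Relation.Unary using (Pred)
open import Relation.Binary using (Rel; IsPartialOrder)

record CompleteLattice (ℓ : Level) : Set (Level.suc ℓ) where
  infix 4 _≈_ _≤_
  field
    Carrier        : Set ℓ
    _≈_            : Rel Carrier ℓ
    _≤_            : Rel Carrier ℓ
    isPartialOrder : IsPartialOrder _≈_ _≤_
    ⋀              : Pred Carrier ℓ → Carrier
    ⋀-lower        : ∀ (P : Pred Carrier ℓ) {x} → P x → ⋀ P ≤ x
    ⋀-greatest     : ∀ (P : Pred Carrier ℓ) {y} → (∀ {x} → P x → y ≤ x) → y ≤ ⋀ P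
    ⋁              : Pred Carrier ℓ → Carrier
    ⋁-upper        : ∀ (P : Pred Carrier ℓ) {x} → P x → x ≤ ⋁ P
    ⋁-least        : ∀ (P : Pred Carrier ℓ) {y} → (∀ {x} → P x → x ≤ y) → ⋁ P ≤ y

  ⊤ : Carrier
  ⊤ = ⋀ (λ _ → Lift ℓ ⊥)

  Monotone : (Carrier → Carrier) → Set ℓ
  Monotone g = ∀ {x y} → x ≤ y → g x ≤ g y

  -- least / greatest fixpoints (Knaster–Tarski), for monotone g these are
  -- the least / greatest fixpoint of g
  lfp : (Carrier → Carrier) → Carrier
  lfp g = ⋀ (λ x → g x ≤ x)

  gfp : (Carrier → Carrier) → Carrier
  gfp g = ⋁ (λ x → x ≤ g x)

  Tuple : ℕ → Set ℓ
  Tuple m = Fin m → Carrier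

  _≤ᵗ_ : ∀ {m} → Tuple m → Tuple m → Set ℓ
  u ≤ᵗ v = ∀ i → u i ≤ v i

  MonotoneTuple : ∀ {m} → (Tuple m → Carrier) → Set ℓ
  MonotoneTuple f = ∀ {u v} → u ≤ᵗ v → f u ≤ f v

open CompleteLattice public using (Carrier)

data FP : Set where
  μ ν : FP

-- (x₁,…,x_m) ↦ (x₁,…,x_m,l), i.e. index fromℕ m carries l and inject₁ i carries x i
extend : ∀ {a} {X : Set a} {m : ℕ} → (Fin m → X) → X → Fin (N.suc m) → X
extend {m = N.zero}  x l zero    = l
extend {m = N.suc m} x l zero    = x zero
extend {m = N.suc m} x l (suc j) = extend (λ k → x (suc k)) l j

module _ {ℓ : Level} (L : CompleteLattice ℓ) where
  open CompleteLattice L hiding (Carrier)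
  private Car = CompleteLattice.Carrier L

  fix : FP → (Car → Car) → Car
  fix μ g = lfp g
  fix ν g = gfp g

  -- solution of the system x_i =_{η i} f i (x₁,…,x_m), by induction on m:
  -- sol(E) = (sol(E[x_m := s_m]), s_m),  s_m = η_m(λx. f_m(sol(E[x_m:=x]), x))
  sol : (m : ℕ) → (Fin m → FP) → (Fin m → Tuple m → Car) → Tuple m
  sol N.zero    η f ()
  sol (N.suc m) η f = extend (solSub s) s
    where
      η' : Fin m → FP
      η' i = η (inject₁ i)
      solSub : Car → Tuple m
      solSub l = sol m η' (λ i y → f (inject₁ i) (extend y l))
      s : Car
      s = fix (η (fromℕ m)) (λ x → f (fromℕ m) (extend (solSub x) x))

CoContinuous : ∀ {ℓ} (A C : CompleteLattice ℓ) → (Carrier A → Carrier C) → Set (Level.suc ℓ)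
CoContinuous {ℓ} A C γ =
  ∀ (P : Pred (Carrier A) ℓ) →
    (∃ λ a → P a) →
    (∀ {x y} → P x → P y → Σ[ z ∈ Carrier A ] (P z × z A.≤ x × z A.≤ y)) →
    γ (A.⋀ P) C.≈ (C.⋀ (λ c → Σ[ a ∈ Carrier A ] (P a × c C.≈ γ a)))
  where
    module A = CompleteLattice A
    module C = CompleteLattice C

CoStrict : ∀ {ℓ} (A C : CompleteLattice ℓ) → (Carrier A → Carrier C) → Set ℓ
CoStrict A C γ = CompleteLattice._≈_ C (γ (CompleteLattice.⊤ A)) (CompleteLattice.⊤ C)

-- μ-equations transfer by the usual induction principle for least fixpoints.  For a
-- ν-equation one needs a post-fixed point a of f^A with s^C ⊑ γ(a).  The set S of
-- prefixed points a of f^A with s^C ⊑ γ(a) contains ⊤ (co-strictness), is closed under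
-- f^A (the simulation) and under filtered meets (co-continuity); a Pataraia-style
-- argument (the meet of all monotone deflationary self-maps of S, applied to ⊤) then
-- yields a point of S that is also post-fixed, without any transfinite iteration.
module Submission where

open import Defs
open import Level using (Level; lift)
open import Data.Nat using (ℕ)
import Data.Nat as Nat
open import Data.Fin using (Fin; zero; suc; inject₁; fromℕ)
open import Data.Product using (_×_; _,_; proj₁; proj₂; ∃-syntax)
open import Function using (_∘_)
open import Relation.Binary using (IsPartialOrder)
open import Relation.Binary.PropositionalEquality using (_≡_; refl)
open import Relation.Unary using (Pred; Satisfiable; _⊆_)

extend-pointwise : ∀ {a b r} {X : Set a} {Y : Set b} {m : ℕ}
  (R : Fin (Nat.suc m) → X → Y → Set r) {u : Fin m → X} {v : Fin m → Y} {x : X} {y : Y}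
  → (∀ i → R (inject₁ i) (u i) (v i)) → R (fromℕ m) x y
  → ∀ i → R i (extend u x i) (extend v y i)
extend-pointwise {m = Nat.zero}  R us xy zero    = xy
extend-pointwise {m = Nat.suc m} R us xy zero    = us zero
extend-pointwise {m = Nat.suc m} R us xy (suc i) =
  extend-pointwise (R ∘ suc) (us ∘ suc) xy i

module LatticeProperties {ℓ : Level} (L : CompleteLattice ℓ) where
  open CompleteLattice L hiding (Carrier)
  private
    Car : Set ℓ
    Car = CompleteLattice.Carrier L
  open IsPartialOrder isPartialOrder public using () renaming (refl to ≤-refl; trans to ≤-trans)
  open IsPartialOrder isPartialOrder using (module Eq; reflexive)

  ≥-reflexive : ∀ {x y} → x ≈ y → y ≤ x
  ≥-reflexive = reflexive ∘ Eq.sym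

  ⊤-maximum : ∀ {x} → x ≤ ⊤
  ⊤-maximum = ⋀-greatest _ (λ { (lift ()) })

  lfp-least : ∀ g {x} → g x ≤ x → lfp g ≤ x
  lfp-least g = ⋀-lower _

  lfp-prefixed : ∀ {g} → Monotone g → g (lfp g) ≤ lfp g
  lfp-prefixed g-mono =
    ⋀-greatest _ (λ gx≤x → ≤-trans (g-mono (⋀-lower _ gx≤x)) gx≤x)

  gfp-greatest : ∀ g {x} → x ≤ g x → x ≤ gfp g
  gfp-greatest g = ⋁-upper _

  gfp-postfixed : ∀ {g} → Monotone g → gfp g ≤ g (gfp g)
  gfp-postfixed g-mono =
    ⋁-least _ (λ x≤gx → ≤-trans x≤gx (g-mono (⋁-upper _ x≤gx)))

  fix-mono : ∀ e {g g'} → (∀ x → g x ≤ g' x) → fix L e g ≤ fix L e g'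
  fix-mono μ g≤g' = ⋀-greatest _ (λ {x} g'x≤x → ⋀-lower _ (≤-trans (g≤g' x) g'x≤x))
  fix-mono ν g≤g' = ⋁-least _ (λ {x} x≤gx → ⋁-upper _ (≤-trans x≤gx (g≤g' x)))

  extend-mono : ∀ {m} {u v : Tuple m} {x y}
    → u ≤ᵗ v → x ≤ y → extend u x ≤ᵗ extend v y
  extend-mono = extend-pointwise (λ _ → _≤_)

  Filtered : Pred Car ℓ → Set ℓ
  Filtered P = ∀ {x y} → P x → P y → ∃[ z ] (P z × z ≤ x × z ≤ y)

  FilteredMeetClosed : Pred Car ℓ → Set (Level.suc ℓ)
  FilteredMeetClosed S = ∀ P → Satisfiable P → Filtered P → P ⊆ S → S (⋀ P)

  module _ (S : Pred Car ℓ) (S-⊤ : S ⊤) (S-⋀ : FilteredMeetClosed S)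
           {g : Car → Car} (g-mono : Monotone g)
           (S-g : ∀ {a} → S a → S (g a))
           (g-deflationary : ∀ {a} → S a → g a ≤ a) where

    record Admissible (h : Car → Car) : Set ℓ where
      field
        preserves    : ∀ {a} → S a → S (h a)
        monotone     : ∀ {a b} → S a → S b → a ≤ b → h a ≤ h b
        deflationary : ∀ {a} → S a → h a ≤ a
    open Admissible

    id-admissible : Admissible (λ a → a)
    id-admissible = record
      { preserves = λ sa → sa
      ; monotone = λ _ _ a≤b → a≤b
      ; deflationary = λ _ → ≤-refl
      }

    ∘-admissible : ∀ {h k} → Admissible h → Admissible k → Admissible (h ∘ k)
    ∘-admissible H K = record
      { preserves    = preserves H ∘ preserves K
      ; monotone     = λ sa sb a≤b →
          monotone H (preserves K sa) (preserves K sb) (monotone K sa sb a≤b)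
      ; deflationary = λ sa →
          ≤-trans (deflationary H (preserves K sa)) (deflationary K sa)
      }

    Orbit : Car → Pred Car ℓ
    Orbit a x = ∃[ h ] (Admissible h × x ≡ h a)

    least-admissible : Car → Car
    least-admissible a = ⋀ (Orbit a)

    orbit-filtered : ∀ {a} → S a → Filtered (Orbit a)
    orbit-filtered {a} sa (h , H , refl) (k , K , refl) =
      h (k a) , (h ∘ k , ∘-admissible H K , refl)
      , monotone H (preserves K sa) sa (deflationary K sa)
      , deflationary H (preserves K sa)

    least-admissible-admissible : Admissible least-admissible
    least-admissible-admissible = record
      { preserves    = λ {a} sa → S-⋀ (Orbit a) (a , (λ x → x) , id-admissible , refl)
          (orbit-filtered sa) (λ { (h , H , refl) → preserves H sa })
      ; monotone     = λ {a} {b} sa sb a≤b → ⋀-greatest (Orbit b) (λ { (h , H , refl) →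
          ≤-trans (⋀-lower (Orbit a) (h , H , refl)) (monotone H sa sb a≤b) })
      ; deflationary = λ {a} _ → ⋀-lower (Orbit a) ((λ x → x) , id-admissible , refl)
      }

    g-admissible : Admissible g
    g-admissible = record
      { preserves = S-g ; monotone = λ _ _ → g-mono ; deflationary = g-deflationary }

    ∃-postfixed-in-meet-closed : ∃[ a ] (S a × a ≤ g a)
    ∃-postfixed-in-meet-closed =
      least-admissible ⊤
      , preserves least-admissible-admissible S-⊤
      , ⋀-lower (Orbit ⊤) (g ∘ least-admissible
                          , ∘-admissible g-admissible least-admissible-admissible , refl)

  Equations : ℕ → Set ℓ
  Equations m = Fin m → Tuple m → Car

  MonotoneEquations : ∀ {m} → Equations m → Set ℓ
  MonotoneEquations f = ∀ i → MonotoneTuple (f i)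

  substLast : ∀ {m} → Equations (Nat.suc m) → Car → Equations m
  substLast f l i y = f (inject₁ i) (extend y l)

  -- E[x_m := l] is substLast; solSubst and lastEquation unfold to the local
  -- functions of sol, so sol L (suc m) η f is extend (solSubst η f s) s definitionally.
  module _ {m : ℕ} (η : Fin (Nat.suc m) → FP) where

    solSubst : Equations (Nat.suc m) → Car → Tuple m
    solSubst f l = sol L m (η ∘ inject₁) (substLast f l)

    lastEquation : Equations (Nat.suc m) → Car → Car
    lastEquation f x = f (fromℕ m) (extend (solSubst f x) x)

  substLast-mono : ∀ {m} {f : Equations (Nat.suc m)} {l}
    → MonotoneEquations f → MonotoneEquations (substLast f l)
  substLast-mono f-mono i u≤v = f-mono (inject₁ i) (extend-mono u≤v ≤-refl)

  mutual
    sol-mono : ∀ m η {f f' : Equations m} → MonotoneEquations f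
      → (∀ i u → f i u ≤ f' i u) → sol L m η f ≤ᵗ sol L m η f'
    sol-mono Nat.zero    η f-mono f≤f' ()
    sol-mono (Nat.suc m) η {f} {f'} f-mono f≤f' =
      extend-mono (solSubst-mono η f-mono f≤f' s≤s') s≤s'
      where
        s≤s' : fix L (η (fromℕ m)) (lastEquation η f)
             ≤ fix L (η (fromℕ m)) (lastEquation η f')
        s≤s' = fix-mono (η (fromℕ m)) (λ x → ≤-trans
          (f-mono (fromℕ m) (extend-mono (solSubst-mono η f-mono f≤f' ≤-refl) ≤-refl))
          (f≤f' (fromℕ m) _))

    solSubst-mono : ∀ {m} η {f f' : Equations (Nat.suc m)} → MonotoneEquations f
      → (∀ i u → f i u ≤ f' i u)
      → ∀ {x y} → x ≤ y → solSubst η f x ≤ᵗ solSubst η f' y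
    solSubst-mono η f-mono f≤f' x≤y = sol-mono _ (η ∘ inject₁) (substLast-mono f-mono)
      (λ i u → ≤-trans (f-mono (inject₁ i) (extend-mono (λ _ → ≤-refl) x≤y))
                       (f≤f' (inject₁ i) _))

  lastEquation-mono : ∀ {m} η {f : Equations (Nat.suc m)}
    → MonotoneEquations f → Monotone (lastEquation η f)
  lastEquation-mono {m} η f-mono x≤y =
    f-mono (fromℕ m) (extend-mono (solSubst-mono η f-mono (λ _ _ → ≤-refl) x≤y) x≤y)

module Transfer {ℓ : Level} (C A : CompleteLattice ℓ) where
  module C = CompleteLattice C
  module A = CompleteLattice A
  module PC = LatticeProperties C
  module PA = LatticeProperties A

  MonotoneMap : (A.Carrier → C.Carrier) → Set ℓ
  MonotoneMap γ = ∀ {a b} → a A.≤ b → γ a C.≤ γ b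

  Simulation : (A.Carrier → C.Carrier)
    → (C.Carrier → C.Carrier) → (A.Carrier → A.Carrier) → Set ℓ
  Simulation γ gC gA = ∀ a → gC (γ a) C.≤ γ (gA a)

  module _ {γ : A.Carrier → C.Carrier} (γ-mono : MonotoneMap γ)
           {gC : C.Carrier → C.Carrier} {gA : A.Carrier → A.Carrier}
           (gC-mono : C.Monotone gC) (gA-mono : A.Monotone gA)
           (sim : Simulation γ gC gA) where

    lfp-transfer : C.lfp gC C.≤ γ (A.lfp gA)
    lfp-transfer = PC.lfp-least gC (PC.≤-trans (sim _) (γ-mono (PA.lfp-prefixed gA-mono)))

    gfp-transfer : CoContinuous A C γ → CoStrict A C γ → C.gfp gC C.≤ γ (A.gfp gA)
    gfp-transfer γ-cocont γ-costrict =
      PC.≤-trans (proj₁ (proj₁ (proj₂ postfixed)))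
                 (γ-mono (PA.gfp-greatest gA (proj₂ (proj₂ postfixed))))
      where
        Below : Pred A.Carrier ℓ
        Below a = C.gfp gC C.≤ γ a × gA a A.≤ a

        Below-⊤ : Below A.⊤
        Below-⊤ = PC.≤-trans PC.⊤-maximum (PC.≥-reflexive γ-costrict) , PA.⊤-maximum

        Below-⋀ : PA.FilteredMeetClosed Below
        Below-⋀ P nonempty filtered P⊆Below =
          PC.≤-trans (C.⋀-greatest _ (λ { (a , Pa , c≈γa) →
              PC.≤-trans (proj₁ (P⊆Below Pa)) (PC.≥-reflexive c≈γa) }))
            (PC.≥-reflexive (γ-cocont P nonempty filtered))
          , A.⋀-greatest P (λ Pa →
              PA.≤-trans (gA-mono (A.⋀-lower P Pa)) (proj₂ (P⊆Below Pa)))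

        Below-gA : ∀ {a} → Below a → Below (gA a)
        Below-gA (c≤γa , ga≤a) =
          PC.≤-trans (PC.gfp-postfixed gC-mono) (PC.≤-trans (gC-mono c≤γa) (sim _))
          , gA-mono ga≤a

        postfixed : ∃[ a ] (Below a × a A.≤ gA a)
        postfixed =
          PA.∃-postfixed-in-meet-closed Below Below-⊤ Below-⋀ gA-mono Below-gA proj₂

    fix-transfer : ∀ e → (e ≡ ν → CoContinuous A C γ × CoStrict A C γ)
      → fix C e gC C.≤ γ (fix A e gA)
    fix-transfer μ _ = lfp-transfer
    fix-transfer ν co = gfp-transfer (proj₁ (co refl)) (proj₂ (co refl))

theorem4p1 : {ℓ : Level} (C A : CompleteLattice ℓ) (m : ℕ) (η : Fin m → FP)
    (fC : Fin m → (Fin m → Carrier C) → Carrier C)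
    (fA : Fin m → (Fin m → Carrier A) → Carrier A)
    → (∀ i → CompleteLattice.MonotoneTuple C (fC i))
    → (∀ i → CompleteLattice.MonotoneTuple A (fA i))
    → (γ : Fin m → Carrier A → Carrier C)
    → (∀ i {a b} → CompleteLattice._≤_ A a b → CompleteLattice._≤_ C (γ i a) (γ i b))
    → (∀ (a : Fin m → Carrier A) i → CompleteLattice._≤_ C (fC i (λ j → γ j (a j))) (γ i (fA i a)))
    → (∀ i → η i ≡ ν → CoContinuous A C (γ i) × CoStrict A C (γ i))
    → ∀ i → CompleteLattice._≤_ C (sol C m η fC i) (γ i (sol A m η fA i))
theorem4p1 C A Nat.zero η fC fA fC-mono fA-mono γ γ-mono sim co ()
theorem4p1 C A (Nat.suc m) η fC fA fC-mono fA-mono γ γ-mono sim co =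
  extend-below (solSubst-transfer sC≤γsA) sC≤γsA
  where
    open Transfer C A
    last : Fin (Nat.suc m)
    last = fromℕ m

    extend-below : ∀ {u v x a}
      → (∀ i → u i C.≤ γ (inject₁ i) (v i)) → x C.≤ γ last a
      → ∀ i → extend u x i C.≤ γ i (extend v a i)
    extend-below = extend-pointwise (λ i c a → c C.≤ γ i a)

    solSubst-transfer : ∀ {x a} → x C.≤ γ last a
      → ∀ i → PC.solSubst η fC x i C.≤ γ (inject₁ i) (PA.solSubst η fA a i)
    solSubst-transfer x≤γa = theorem4p1 C A m (η ∘ inject₁) _ _
      (PC.substLast-mono fC-mono) (PA.substLast-mono fA-mono)
      (γ ∘ inject₁) (γ-mono ∘ inject₁)
      (λ b i → PC.≤-trans (fC-mono (inject₁ i) (extend-below (λ _ → PC.≤-refl) x≤γa))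
                          (sim (extend b _) (inject₁ i)))
      (co ∘ inject₁)

    lastEquation-simulation :
      Simulation (γ last) (PC.lastEquation η fC) (PA.lastEquation η fA)
    lastEquation-simulation a = PC.≤-trans
      (fC-mono last (extend-below (solSubst-transfer PC.≤-refl) PC.≤-refl)) (sim _ last)

    sC≤γsA : fix C (η last) (PC.lastEquation η fC)
             C.≤ γ last (fix A (η last) (PA.lastEquation η fA))
    sC≤γsA = fix-transfer (γ-mono last) (PC.lastEquation-mono η fC-mono)
      (PA.lastEquation-mono η fA-mono) lastEquation-simulation (η last) (co last)
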